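{- Let $G$ and $H$ be graphs each of order at least $2$. Then $\gamma_{mt}^{2}(G+H)=2$.
   Context: All graphs are finite, simple and undirected. The join $G+H$ is the graph with vertex set $V(G)\cup V(H)$ (disjoint union) whose edges are those of $G$, those of $H$, and all edges $uv$ with $u\in V(G)$, $v\in V(H)$. A set $S \subseteq V(X)$ is a total dominating set of a graph $X$ if every vertex of $V(X)$ is adjacent to some vertex of $S$. A non-empty $T\subseteq V(X)$ is a 2-movable total dominating set of a connected graph $X$ if $T$ is a total dominating set and for every pair $x,y\in T$, either $T\setminus\{x,y\}$ is a total dominating set of $X$, or there exist $u,v\in V(X)\setminus T$ such that $u$ is adjacent to $x$, $v$ is adjacent to $y$, and $(T\setminus\{x,y\})\cup\{u,v\}$ is a total dominating set of $X$. $\gamma_{mt}^2(X)$ is the minimum cardinality of a 2-movable total dominating set of $X$. -}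

module Defs where

open import Level using (0ℓ)
open import Data.Nat using (ℕ; _+_; _≤_)
open import Data.Fin using (Fin; splitAt)
open import Data.Fin.Subset using (Subset; _∈_; _∉_; _-_; _∪_; ⁅_⁆; ∣_∣; Nonempty)
open import Data.Sum using (_⊎_; inj₁; inj₂)
open import Data.Product using (Σ; ∃; ∃₂; _×_)
open import Data.Unit using (⊤)
open import Data.Empty using (⊥)
open import Relation.Binary.PropositionalEquality using (_≡_; _≢_)
open import Relation.Nullary using (¬_)

record Graph : Set₁ where
  field
    order  : ℕ
    Adj    : Fin order → Fin order → Set
    sym    : ∀ {u v} → Adj u v → Adj v u
    irrefl : ∀ {u} → ¬ Adj u u

open Graph public

-- Join G + H on vertex set Fin (order G + order H):
-- the first order G vertices form G, the rest form H.
JoinAdj : (G H : Graph) → Fin (order G + order H) → Fin (order G + order H) → Set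
JoinAdj G H i j with splitAt (order G) i | splitAt (order G) j
... | inj₁ a | inj₁ b = Adj G a b
... | inj₂ a | inj₂ b = Adj H a b
... | inj₁ _ | inj₂ _ = ⊤
... | inj₂ _ | inj₁ _ = ⊤

private
  joinSym : (G H : Graph) → ∀ {i j} → JoinAdj G H i j → JoinAdj G H j i
  joinSym G H {i} {j} p with splitAt (order G) i | splitAt (order G) j
  ... | inj₁ a | inj₁ b = sym G p
  ... | inj₂ a | inj₂ b = sym H p
  ... | inj₁ _ | inj₂ _ = p
  ... | inj₂ _ | inj₁ _ = p

  joinIrrefl : (G H : Graph) → ∀ {i} → ¬ JoinAdj G H i i
  joinIrrefl G H {i} p with splitAt (order G) i
  ... | inj₁ a = irrefl G p
  ... | inj₂ a = irrefl H p

_+ᴳ_ : Graph → Graph → Graph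
G +ᴳ H = record
  { order  = order G + order H
  ; Adj    = JoinAdj G H
  ; sym    = joinSym G H
  ; irrefl = joinIrrefl G H
  }

IsTDS : (X : Graph) → Subset (order X) → Set
IsTDS X S = ∀ v → ∃ λ w → w ∈ S × Adj X v w

Is2MTDS : (X : Graph) → Subset (order X) → Set
Is2MTDS X T =
  Nonempty T × IsTDS X T ×
  (∀ x y → x ∈ T → y ∈ T → x ≢ y →
     IsTDS X ((T - x) - y)
     ⊎ ∃₂ λ u v → u ∉ T × v ∉ T × Adj X u x × Adj X v y ×
                  IsTDS X ((((T - x) - y) ∪ ⁅ u ⁆) ∪ ⁅ v ⁆))

γmt2≡ : (X : Graph) → ℕ → Set
γmt2≡ X k =
  (∃ λ T → Is2MTDS X T × ∣ T ∣ ≡ k) ×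
  (∀ T → Is2MTDS X T → k ≤ ∣ T ∣)

module Submission where

-- A total dominating set has at least two vertices: some w ∈ S dominates a vertex, some
-- w' ∈ S dominates w, and w' ≠ w since graphs are loopless. In G + H every vertex is adjacent
-- to the whole opposite side, so any set containing a vertex of each side totally dominates.
-- Hence {a, b} with a ∈ G, b ∈ H works, and it is 2-movable: a moves to a spare vertex b' ≠ b
-- of H and b to a spare vertex a' ≠ a of G, again leaving one vertex on each side.

open import Defs hiding (sym)
open import Data.Nat using (ℕ; _+_; _≤_; _<_; z≤n; s≤s)
open import Data.Nat.Properties using (≤-trans; ≤-<-trans; ≤-antisym; ≤-reflexive; +-suc; +-monoʳ-≤; n≤1+n)
open import Data.Fin using (Fin; zero; suc; splitAt; _↑ˡ_; _↑ʳ_)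
open import Data.Fin.Properties using (splitAt-↑ˡ; splitAt-↑ʳ; splitAt⁻¹-↑ˡ; splitAt⁻¹-↑ʳ; ↑ˡ-injective; ↑ʳ-injective)
open import Data.Fin.Subset using (Subset; inside; outside; _∈_; _∉_; _-_; _∪_; ⁅_⁆; ∣_∣)
open import Data.Fin.Subset.Properties using (x∈p∪q⁻; x∈p∪q⁺; x∈⁅x⁆; x∈⁅y⁆⇒x≡y; ∣⁅x⁆∣≡1; x∈p∧x≢y⇒x∈p-y; x∈p⇒∣p-x∣<∣p∣)
open import Data.Vec using (_∷_; [])
open import Data.Sum using (_⊎_; inj₁; inj₂)
import Data.Sum as Sum
open import Data.Product using (∃; ∃₂; _×_; _,_)
open import Data.Unit using (tt)
open import Function using (_∘_)
open import Relation.Nullary using (contradiction)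
open import Relation.Binary.PropositionalEquality using (_≡_; _≢_; refl; sym; trans; cong; cong₂; subst)

private
  variable
    n : ℕ

∣p∪q∣≤∣p∣+∣q∣ : (p q : Subset n) → ∣ p ∪ q ∣ ≤ ∣ p ∣ + ∣ q ∣
∣p∪q∣≤∣p∣+∣q∣ []            []            = z≤n
∣p∪q∣≤∣p∣+∣q∣ (outside ∷ p) (outside ∷ q) = ∣p∪q∣≤∣p∣+∣q∣ p q
∣p∪q∣≤∣p∣+∣q∣ (outside ∷ p) (inside  ∷ q) =
  ≤-trans (s≤s (∣p∪q∣≤∣p∣+∣q∣ p q)) (≤-reflexive (sym (+-suc ∣ p ∣ ∣ q ∣)))
∣p∪q∣≤∣p∣+∣q∣ (inside  ∷ p) (outside ∷ q) = s≤s (∣p∪q∣≤∣p∣+∣q∣ p q)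
∣p∪q∣≤∣p∣+∣q∣ (inside  ∷ p) (inside  ∷ q) =
  s≤s (≤-trans (∣p∪q∣≤∣p∣+∣q∣ p q) (+-monoʳ-≤ ∣ p ∣ (n≤1+n ∣ q ∣)))

∈⇒0<∣p∣ : {x : Fin n} {p : Subset n} → x ∈ p → 0 < ∣ p ∣
∈⇒0<∣p∣ x∈p = ≤-<-trans z≤n (x∈p⇒∣p-x∣<∣p∣ x∈p)

∈∧∈∧≢⇒2≤∣p∣ : {x y : Fin n} {p : Subset n} → x ∈ p → y ∈ p → x ≢ y → 2 ≤ ∣ p ∣
∈∧∈∧≢⇒2≤∣p∣ x∈p y∈p x≢y =
  ≤-trans (s≤s (∈⇒0<∣p∣ (x∈p∧x≢y⇒x∈p-y y∈p (x≢y ∘ sym)))) (x∈p⇒∣p-x∣<∣p∣ x∈p)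

∣⁅x⁆∪⁅y⁆∣≡2 : {x y : Fin n} → x ≢ y → ∣ ⁅ x ⁆ ∪ ⁅ y ⁆ ∣ ≡ 2
∣⁅x⁆∪⁅y⁆∣≡2 {x = x} {y} x≢y = ≤-antisym ∣⁅x⁆∪⁅y⁆∣≤2 (∈∧∈∧≢⇒2≤∣p∣ x∈⁅x⁆∪⁅y⁆ y∈⁅x⁆∪⁅y⁆ x≢y)
  where
  ∣⁅x⁆∪⁅y⁆∣≤2 : ∣ ⁅ x ⁆ ∪ ⁅ y ⁆ ∣ ≤ 2
  ∣⁅x⁆∪⁅y⁆∣≤2 = ≤-trans (∣p∪q∣≤∣p∣+∣q∣ ⁅ x ⁆ ⁅ y ⁆) (≤-reflexive (cong₂ _+_ (∣⁅x⁆∣≡1 x) (∣⁅x⁆∣≡1 y)))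
  x∈⁅x⁆∪⁅y⁆ : x ∈ ⁅ x ⁆ ∪ ⁅ y ⁆
  x∈⁅x⁆∪⁅y⁆ = x∈p∪q⁺ (inj₁ (x∈⁅x⁆ x))
  y∈⁅x⁆∪⁅y⁆ : y ∈ ⁅ x ⁆ ∪ ⁅ y ⁆
  y∈⁅x⁆∪⁅y⁆ = x∈p∪q⁺ (inj₂ (x∈⁅x⁆ y))

x∈⁅y⁆∪⁅z⁆⇒x≡y⊎x≡z : {x y z : Fin n} → x ∈ ⁅ y ⁆ ∪ ⁅ z ⁆ → x ≡ y ⊎ x ≡ z
x∈⁅y⁆∪⁅z⁆⇒x≡y⊎x≡z {y = y} {z} = Sum.map (x∈⁅y⁆⇒x≡y y) (x∈⁅y⁆⇒x≡y z) ∘ x∈p∪q⁻ ⁅ y ⁆ ⁅ z ⁆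

x∈p∪⁅x⁆∪⁅y⁆ : (p : Subset n) (x y : Fin n) → x ∈ (p ∪ ⁅ x ⁆) ∪ ⁅ y ⁆
x∈p∪⁅x⁆∪⁅y⁆ p x y = x∈p∪q⁺ (inj₁ (x∈p∪q⁺ (inj₂ (x∈⁅x⁆ x))))

y∈p∪⁅x⁆∪⁅y⁆ : (p : Subset n) (x y : Fin n) → y ∈ (p ∪ ⁅ x ⁆) ∪ ⁅ y ⁆
y∈p∪⁅x⁆∪⁅y⁆ p x y = x∈p∪q⁺ (inj₂ (x∈⁅x⁆ y))

2≤n⇒∃i≢j : 2 ≤ n → ∃₂ λ (i j : Fin n) → i ≢ j
2≤n⇒∃i≢j (s≤s (s≤s _)) = zero , suc zero , λ ()

isTDS⇒2≤∣S∣ : (X : Graph) {S : Subset (order X)} → IsTDS X S → Fin (order X) → 2 ≤ ∣ S ∣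
isTDS⇒2≤∣S∣ X S-tds v =
  let (w  , w∈S  , _)    = S-tds v
      (w′ , w′∈S , w~w′) = S-tds w
  in ∈∧∈∧≢⇒2≤∣p∣ w∈S w′∈S λ w≡w′ → irrefl X (subst (Adj X w) (sym w≡w′) w~w′)

module Join (G H : Graph) where

  private
    X = G +ᴳ H

  fromG : Fin (order G) → Fin (order X)
  fromG a = a ↑ˡ order H

  fromH : Fin (order H) → Fin (order X)
  fromH b = order G ↑ʳ b

  fromG≢fromH : ∀ {a b} → fromG a ≢ fromH b
  fromG≢fromH {a} {b} e with
    trans (sym (splitAt-↑ˡ (order G) a (order H))) (trans (cong (splitAt (order G)) e) (splitAt-↑ʳ (order G) (order H) b))
  ... | ()

  fromG-or-fromH : ∀ v → (∃ λ a → fromG a ≡ v) ⊎ (∃ λ b → fromH b ≡ v)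
  fromG-or-fromH v with splitAt (order G) v in eq
  ... | inj₁ a = inj₁ (a , splitAt⁻¹-↑ˡ eq)
  ... | inj₂ b = inj₂ (b , splitAt⁻¹-↑ʳ eq)

  fromG~fromH : ∀ a b → Adj X (fromG a) (fromH b)
  fromG~fromH a b rewrite splitAt-↑ˡ (order G) a (order H) | splitAt-↑ʳ (order G) (order H) b = tt

  fromH~fromG : ∀ b a → Adj X (fromH b) (fromG a)
  fromH~fromG b a = Graph.sym X (fromG~fromH a b)

  isTDS-join : ∀ {S a b} → fromG a ∈ S → fromH b ∈ S → IsTDS X S
  isTDS-join {a = a} {b} a∈S b∈S v with fromG-or-fromH v
  ... | inj₁ (a′ , refl) = fromH b , b∈S , fromG~fromH a′ b
  ... | inj₂ (b′ , refl) = fromG a , a∈S , fromH~fromG b′ a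

  pair : Fin (order G) → Fin (order H) → Subset (order X)
  pair a b = ⁅ fromG a ⁆ ∪ ⁅ fromH b ⁆

  ∣pair∣≡2 : ∀ a b → ∣ pair a b ∣ ≡ 2
  ∣pair∣≡2 a b = ∣⁅x⁆∪⁅y⁆∣≡2 (fromG≢fromH {a} {b})

  fromG∉pair : ∀ {a a′} b → a′ ≢ a → fromG a′ ∉ pair a b
  fromG∉pair b a′≢a a′∈ with x∈⁅y⁆∪⁅z⁆⇒x≡y⊎x≡z a′∈
  ... | inj₁ e = a′≢a (↑ˡ-injective (order H) _ _ e)
  ... | inj₂ e = fromG≢fromH e

  fromH∉pair : ∀ a {b b′} → b′ ≢ b → fromH b′ ∉ pair a b
  fromH∉pair a b′≢b b′∈ with x∈⁅y⁆∪⁅z⁆⇒x≡y⊎x≡z b′∈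
  ... | inj₁ e = fromG≢fromH (sym e)
  ... | inj₂ e = b′≢b (↑ʳ-injective (order G) _ _ e)

  pair-move : ∀ {a a′ b b′} → a′ ≢ a → b′ ≢ b → ∀ {x y} → x ∈ pair a b → y ∈ pair a b → x ≢ y →
              ∃₂ λ u v → u ∉ pair a b × v ∉ pair a b × Adj X u x × Adj X v y ×
                         IsTDS X ((((pair a b - x) - y) ∪ ⁅ u ⁆) ∪ ⁅ v ⁆)
  pair-move {a} {a′} {b} {b′} a′≢a b′≢b x∈ y∈ x≢y
    with x∈⁅y⁆∪⁅z⁆⇒x≡y⊎x≡z x∈ | x∈⁅y⁆∪⁅z⁆⇒x≡y⊎x≡z y∈
  ... | inj₁ refl | inj₁ refl = contradiction refl x≢y
  ... | inj₂ refl | inj₂ refl = contradiction refl x≢y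
  ... | inj₁ refl | inj₂ refl =
    fromH b′ , fromG a′ , fromH∉pair a b′≢b , fromG∉pair b a′≢a , fromH~fromG b′ a , fromG~fromH a′ b ,
    isTDS-join (y∈p∪⁅x⁆∪⁅y⁆ _ _ _) (x∈p∪⁅x⁆∪⁅y⁆ _ _ _)
  ... | inj₂ refl | inj₁ refl =
    fromG a′ , fromH b′ , fromG∉pair b a′≢a , fromH∉pair a b′≢b , fromG~fromH a′ b , fromH~fromG b′ a ,
    isTDS-join (x∈p∪⁅x⁆∪⁅y⁆ _ _ _) (y∈p∪⁅x⁆∪⁅y⁆ _ _ _)

  pair-is2MTDS : ∀ {a a′ b b′} → a′ ≢ a → b′ ≢ b → Is2MTDS X (pair a b)
  pair-is2MTDS {a} {b = b} a′≢a b′≢b =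
    (fromG a , a∈pair) , isTDS-join a∈pair b∈pair ,
    λ _ _ x∈ y∈ x≢y → inj₂ (pair-move a′≢a b′≢b x∈ y∈ x≢y)
    where
    a∈pair : fromG a ∈ pair a b
    a∈pair = x∈p∪q⁺ (inj₁ (x∈⁅x⁆ (fromG a)))
    b∈pair : fromH b ∈ pair a b
    b∈pair = x∈p∪q⁺ (inj₂ (x∈⁅x⁆ (fromH b)))

theorem3p3 : (G H : Graph) → 2 ≤ order G → 2 ≤ order H → γmt2≡ (G +ᴳ H) 2
theorem3p3 G H 2≤|G| 2≤|H| =
  let (a′ , a , a′≢a) = 2≤n⇒∃i≢j 2≤|G|
      (b′ , b , b′≢b) = 2≤n⇒∃i≢j 2≤|H|
  in (pair a b , pair-is2MTDS a′≢a b′≢b , ∣pair∣≡2 a b) ,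
     λ T (_ , T-tds , _) → isTDS⇒2≤∣S∣ (G +ᴳ H) T-tds (fromG a)
  where open Join G H
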